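{- Let $I$ be a normal (R1)-$\gamma$-ideal in the GPEA $P$, put $\sim:=\sim_I$, and let $U$ be the $\gamma$-unitization of $P$. Then the following conditions are mutually equivalent: (i) $\sim^*$ satisfies (C3) on $U$. (ii) $I$ is a normal Riesz $\gamma$-ideal in $P$. (iii) $\sim$ is a $\gamma$-congruence on $P$ that satisfies (C4) and (C5$'$). (iv) $\sim^*$ is a congruence on $U$ that satisfies (C4), (C4$'$), (C5$'$), and (C5).
   Context: $P$ is a GPEA (partial $\oplus$, constant $0$; partial associativity; conjugation; two-sided cancellation; neutral $0$; positivity), ordered by $a\le b$ iff $a\oplus c=b$ for some $c$; for $a\le b$, $a/b$ is the unique $c$ with $a\oplus c=b$ and $b\backslash a$ the unique $d$ with $d\oplus a=b$. $\gamma$ is a unitizing GPEA-automorphism ($\gamma a\oplus b$ defined iff $b\oplus a$ defined). The $\gamma$-unitization $U=P\cup P^\eta$ ($\eta$ a bijection onto a disjoint set, $1:=\eta0$): sums in $P$ as in $P$; $a+\eta b$ defined iff $a\le b$, equal to $\eta(b\backslash a)$; $\eta a+b$ defined iff $\gamma b\le a$, equal to $\eta(\gamma b/a)$; no sums within $P^\eta$; $U$ is a pseudo effect algebra with $\eta a=a^\sim$, $\gamma a=a^{ -- }$ ($x^\sim,x^-$ defined by $x+x^\sim=1=x^-+x$). Ideal: nonempty down-set closed under existing sums; normal: $a\oplus c=c\oplus b$ implies ($a\in I\Leftrightarrow b\in I$); $\gamma$-ideal: $a\in I\Leftrightarrow\gamma a\in I$. (R1): if $i\in I$, $a\oplus b$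 exists, $i\le a\oplus b$, then $i\le j\oplus k$ for some $j,k\in I$, $j\le a$, $k\le b$. Riesz ideal: R1 plus (R2): if $i\in I$, $i\le a$, then (i) if $(a\backslash i)\oplus b$ exists there is $j\in I$, $j\le b$, with $a\oplus(j/b)$ existing; (ii) if $b\oplus(i/a)$ exists there is $k\in I$, $k\le b$, with $(b\backslash k)\oplus a$ existing. $a\sim_I b$ iff there are $i,j\in I$, $i\le a$, $j\le b$, with $a\backslash i=b\backslash j$. Conditions on a relation $\sim$: (C1) equivalence; (C2) $a\oplus b$, $a_1\oplus b_1$ exist, $a\sim a_1$, $b\sim b_1$ imply $a\oplus b\sim a_1\oplus b_1$; (C3) if $a\oplus b$ exists, for any $a_1\sim a$ there is $b_1\sim b$ with $a_1\oplus b_1$ existing, and for any $b_2\sim b$ there is $a_2\sim a$ with $a_2\oplus b_2$ existing; congruence = (C1)–(C3). (C4): $a\sim b$ and ($a\oplus a_1\sim b\oplus b_1$ or $a_1\oplus a\sim b_1\oplus b$) imply $a_1\sim b_1$. (C5): $a\oplus b\sim0$ implies $a\sim b\sim0$. (C5$'$): $a\sim b\oplus c$ implies $a=a_1\oplus a_2$ with $a_1\sim b$, $a_2\sim c$. (C4$'$) (in a PEA): $a\sim b$ implies $a^\sim\sim b^\sim$ and $a^-\sim b^-$. $\gamma$-congruence: $a\sim b\Leftrightarrow\gamma a\sim\gamma b$. $\sim^*$ on $U$: $a\sim^*b$ iff $a\sim b$, $\eta a\sim^*\eta b$ iff $a\sim b$ ($a,b\in P$), elements of $P$ and $P^\eta$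 never related. -}

module Defs where

open import Data.Product using (Σ; ∃; ∃-syntax; _×_; _,_)
open import Data.Sum using (_⊎_; inj₁; inj₂)
open import Data.Empty using (⊥)
open import Relation.Binary.PropositionalEquality using (_≡_)
open import Relation.Binary.Structures using (IsEquivalence)
open import Function.Bundles using (_⇔_)

-- Partial binary operations are encoded as ternary relations:
--   S a b c   means   "a ⊕ b is defined and a ⊕ b = c".

PSum : Set → Set₁
PSum C = C → C → C → Set

Defined : {C : Set} → PSum C → C → C → Set
Defined {C} S a b = ∃[ c ] S a b c

record IsGPEA {C : Set} (S : PSum C) (0# : C) : Set where
  field
    functional : ∀ {a b c c'} → S a b c → S a b c' → c ≡ c'
    assocˡ : ∀ {a b c d e} → S a b d → S d c e → ∃[ f ] (S b c f × S a f e)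
    assocʳ : ∀ {a b c f e} → S b c f → S a f e → ∃[ d ] (S a b d × S d c e)
    conjugation : ∀ {a b c} → S a b c → (∃[ d ] S d a c) × (∃[ e ] S b e c)
    cancelˡ : ∀ {a b b' c} → S a b c → S a b' c → b ≡ b'
    cancelʳ : ∀ {a a' b c} → S a b c → S a' b c → a ≡ a'
    neutralʳ : ∀ a → S a 0# a
    neutralˡ : ∀ a → S 0# a a
    positive : ∀ {a b} → S a b 0# → a ≡ 0# × b ≡ 0#

record GPEA : Set₁ where
  field
    Carrier : Set
    S       : PSum Carrier
    0#      : Carrier
    isGPEA  : IsGPEA S 0#
  open IsGPEA isGPEA public

module PartialOps {C : Set} (S : PSum C) (0# : C) where

  _≤_ : C → C → Set
  a ≤ b = ∃[ c ] S a c b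

  module _ (_∼_ : C → C → Set) where

    C1 : Set
    C1 = IsEquivalence _∼_

    C2 : Set
    C2 = ∀ {a b c a₁ b₁ c₁} → S a b c → S a₁ b₁ c₁ → a ∼ a₁ → b ∼ b₁ → c ∼ c₁

    C3 : Set
    C3 = ∀ {a b c} → S a b c →
           (∀ a₁ → a₁ ∼ a → ∃[ b₁ ] (b₁ ∼ b × Defined S a₁ b₁)) ×
           (∀ b₂ → b₂ ∼ b → ∃[ a₂ ] (a₂ ∼ a × Defined S a₂ b₂))

    Congruence : Set
    Congruence = C1 × C2 × C3

    C4 : Set
    C4 = ∀ {a b a₁ b₁ c d} → a ∼ b →
           ((S a a₁ c × S b b₁ d × c ∼ d) ⊎ (S a₁ a c × S b₁ b d × c ∼ d)) →
           a₁ ∼ b₁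

    C5 : Set
    C5 = ∀ {a b c} → S a b c → c ∼ 0# → a ∼ 0# × b ∼ 0#

    C5' : Set
    C5' = ∀ {a b c d} → S b c d → a ∼ d →
            ∃[ a₁ ] ∃[ a₂ ] (S a₁ a₂ a × a₁ ∼ b × a₂ ∼ c)

    -- (C4') in a PEA with unit 1#: a ∼ b implies a^∼ ∼ b^∼ and a^- ∼ b^-,
    -- where x + x^∼ = 1 = x^- + x.
    C4' : C → Set
    C4' 1# = ∀ {a b} → a ∼ b →
               (∀ {a' b'} → S a a' 1# → S b b' 1# → a' ∼ b') ×
               (∀ {a' b'} → S a' a 1# → S b' b 1# → a' ∼ b')

module OnGPEA (P : GPEA) where
  open GPEA P
  open PartialOps S 0# public

  record IsAutomorphism (γ : Carrier → Carrier) : Set where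
    field
      γ⁻¹       : Carrier → Carrier
      inverseˡ  : ∀ a → γ (γ⁻¹ a) ≡ a
      inverseʳ  : ∀ a → γ⁻¹ (γ a) ≡ a
      preserves : ∀ a b c → S a b c ⇔ S (γ a) (γ b) (γ c)

  Unitizing : (Carrier → Carrier) → Set
  Unitizing γ = ∀ a b → Defined S (γ a) b ⇔ Defined S b a

  module _ (I : Carrier → Set) where

    IsIdeal : Set
    IsIdeal = (∃[ a ] I a) ×
              (∀ {a b} → a ≤ b → I b → I a) ×
              (∀ {a b c} → S a b c → I a → I b → I c)

    Normal : Set
    Normal = ∀ {a b c d} → S a c d → S c b d → (I a ⇔ I b)

    γIdeal : (Carrier → Carrier) → Set
    γIdeal γ = ∀ a → I a ⇔ I (γ a)

    R1 : Set
    R1 = ∀ {i a b c} → I i → S a b c → i ≤ c →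
           ∃[ j ] ∃[ k ] (I j × I k × j ≤ a × k ≤ b ×
                          ∃[ m ] (S j k m × i ≤ m))

    -- (R2)(i): i ≤ a, d = a \ i (d ⊕ i = a), d ⊕ b exists ⇒
    --          ∃ j ∈ I, j ≤ b, with a ⊕ (j / b) existing (j ⊕ e = b).
    -- (R2)(ii): i ≤ a, e = i / a (i ⊕ e = a), b ⊕ e exists ⇒
    --          ∃ k ∈ I, k ≤ b, with (b \ k) ⊕ a existing (f ⊕ k = b).
    R2 : Set
    R2 = (∀ {i a b d} → I i → i ≤ a → S d i a → Defined S d b →
            ∃[ j ] (I j × j ≤ b × ∃[ e ] (S j e b × Defined S a e))) ×
         (∀ {i a b e} → I i → i ≤ a → S i e a → Defined S b e →
            ∃[ k ] (I k × k ≤ b × ∃[ f ] (S f k b × Defined S f a)))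

    Riesz : Set
    Riesz = R1 × R2

    _∼I_ : Carrier → Carrier → Set
    a ∼I b = ∃[ i ] ∃[ j ] (I i × I j × i ≤ a × j ≤ b ×
               ∃[ d ] (S d i a × S d j b))

  γCongruence : (Carrier → Carrier) → (Carrier → Carrier → Set) → Set
  γCongruence γ _∼_ = Congruence _∼_ × (∀ a b → a ∼ b ⇔ γ a ∼ γ b)

  -- γ-unitization U = P ∪ P^η, encoded as Carrier ⊎ Carrier
  -- (inj₁ a = a ∈ P, inj₂ a = η a ∈ P^η)

  module Unitization (γ : Carrier → Carrier) where

    U : Set
    U = Carrier ⊎ Carrier

    0U : U
    0U = inj₁ 0#

    1U : U
    1U = inj₂ 0#

    SU : PSum U
    SU (inj₁ a) (inj₁ b) (inj₁ c) = S a b c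
    -- a + ηb defined iff a ≤ b, equal to η(b \ a)
    SU (inj₁ a) (inj₂ b) (inj₂ d) = a ≤ b × S d a b
    -- ηa + b defined iff γb ≤ a, equal to η(γb / a)
    SU (inj₂ a) (inj₁ b) (inj₂ d) = γ b ≤ a × S (γ b) d a
    SU _ _ _ = ⊥

    _* : (Carrier → Carrier → Set) → U → U → Set
    (_∼_ *) (inj₁ a) (inj₁ b) = a ∼ b
    (_∼_ *) (inj₂ a) (inj₂ b) = a ∼ b
    (_∼_ *) _ _ = ⊥

-- Almost everything in (iii) and (iv) holds for ANY normal (R1)-γ-ideal:
-- ∼ is an equivalence (transitivity uses R1), compatible with ⊕ (C2), satisfies
-- (C4), (C5), (C5') and is γ-invariant; on U the relation ∼* inherits (C1), (C2),
-- (C4), (C4') and (C5) by a case analysis of the three shapes of sums in U.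
-- The only condition that can fail is (C3), and the file shows
--   (C3) for ∼ on P  ⇔  (R2) for I        (C3⇒R2, R2⇒C3)
--   (C3) for ∼* on U ⇔  (C3) for ∼ on P   (C3*⇒C3, FromC3.≈-C3),
-- the second using (C2), (C5') and γ-invariance; (C3) on P also yields (C5') on U.
-- The four conditions are then each equivalent to (C3) for ∼ on P.
--
-- Naming convention for hypotheses: sxyz : S x y z (i.e. x ⊕ y = z), Ix : I x.

module Submission where

open import Defs
open import Data.Product using (_×_; ∃-syntax; _,_; proj₁; proj₂)
open import Data.Sum using (inj₁; inj₂)
open import Relation.Binary.PropositionalEquality using (_≡_; refl; sym; cong; subst; subst₂)
open import Function.Base using (_∘′_)
open import Function.Bundles using (_⇔_; mk⇔; Equivalence)

open Equivalence using (to; from)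

module GPEAFacts (P : GPEA) where
  open GPEA P
  open OnGPEA P

  right≤ : ∀ {a b c} → S a b c → b ≤ c
  right≤ s = proj₂ (conjugation s)

  ≤-trans : ∀ {a b c} → a ≤ b → b ≤ c → a ≤ c
  ≤-trans (_ , s) (_ , t) = let f , _ , u = assocˡ s t in f , u

  ⊕-monoˡ-≤ : ∀ {a' w a b m n} → S a' w a → S a b n → S a' b m → m ≤ n
  ⊕-monoˡ-≤ sa'wa sabn sa'bm =
    let _ , swbf , sa'fn = assocˡ sa'wa sabn
        e , sbef = proj₂ (conjugation swbf)
        _ , sa'bd , sden = assocʳ sbef sa'fn
    in e , subst (λ x → S x e _) (functional sa'bd sa'bm) sden

  definedʳ-≤ : ∀ {x y a z} → x ≤ y → S y a z → Defined S x a
  definedʳ-≤ (_ , sxty) syaz =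
    let _ , st'xy = proj₁ (conjugation sxty)
        f , sxaf , _ = assocˡ st'xy syaz
    in f , sxaf

  definedˡ-≤ : ∀ {x y a z} → x ≤ y → S a y z → Defined S a x
  definedˡ-≤ (_ , sxty) sayz = let d , saxd , _ = assocʳ sxty sayz in d , saxd

module NormalIdealFacts (P : GPEA) (I : GPEA.Carrier P → Set)
  (idl : OnGPEA.IsIdeal P I) (nm : OnGPEA.Normal P I) where
  open GPEA P
  open OnGPEA P
  open GPEAFacts P

  I-down : ∀ {a b} → a ≤ b → I b → I a
  I-down = proj₁ (proj₂ idl)

  I-closed : ∀ {a b c} → S a b c → I a → I b → I c
  I-closed = proj₂ (proj₂ idl)

  I-zero : I 0#
  I-zero = let a , Ia = proj₁ idl in I-down (a , neutralˡ a) Ia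

  -- Normality lets an ideal summand be moved to the other side of a sum.
  moveˡ : ∀ {d i a} → S d i a → I i → ∃[ x ] (S x d a × I x)
  moveˡ sdia Ii = let x , sxda = proj₁ (conjugation sdia) in x , sxda , from (nm sxda sdia) Ii

  moveʳ : ∀ {i d a} → S i d a → I i → ∃[ y ] (S d y a × I y)
  moveʳ sida Ii = let y , sdya = proj₂ (conjugation sida) in y , sdya , to (nm sida sdya) Ii

  _∼_ : Carrier → Carrier → Set
  _∼_ = _∼I_ I

  ∼-intro : ∀ {a b d i j} → S d i a → S d j b → I i → I j → a ∼ b
  ∼-intro {i = i} {j} sdia sdjb Ii Ij = i , j , Ii , Ij , right≤ sdia , right≤ sdjb , _ , sdia , sdjb

  ∼-introˡ : ∀ {a b d i j} → S i d a → S j d b → I i → I j → a ∼ b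
  ∼-introˡ sida sjdb Ii Ij =
    let _ , sdya , Iy = moveʳ sida Ii
        _ , sdzb , Iz = moveʳ sjdb Ij
    in ∼-intro sdya sdzb Iy Iz

  ∼-elimˡ : ∀ {a b} → a ∼ b → ∃[ d ] ∃[ i ] ∃[ j ] (S i d a × S j d b × I i × I j)
  ∼-elimˡ (_ , _ , Ii , Ij , _ , _ , d , sdia , sdjb) =
    let x , sxda , Ix = moveˡ sdia Ii
        y , sydb , Iy = moveˡ sdjb Ij
    in d , x , y , sxda , sydb , Ix , Iy

  ∼-refl : ∀ {a} → a ∼ a
  ∼-refl {a} = ∼-intro (neutralʳ a) (neutralʳ a) I-zero I-zero

  ∼-sym : ∀ {a b} → a ∼ b → b ∼ a
  ∼-sym (i , j , Ii , Ij , i≤a , j≤b , d , sdia , sdjb) = j , i , Ij , Ii , j≤b , i≤a , d , sdjb , sdia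

  sum-modulo-I : ∀ {d i a e j b c} → S d i a → S e j b → S a b c → I i → I j →
                 ∃[ k ] ∃[ h ] (S d e k × S k h c × I h)
  sum-modulo-I sdia sejb sabc Ii Ij =
    let _ , sibf , sdfc = assocˡ sdia sabc
        _ , sieg , sgjf = assocʳ sejb sibf
        _ , sei'g = proj₂ (conjugation sieg)
        h , si'jh , sehf = assocˡ sei'g sgjf
        k , sdek , skhc = assocʳ sehf sdfc
    in k , h , sdek , skhc , I-closed si'jh (to (nm sieg sei'g) Ii) Ij

  ∼-C2 : C2 _∼_
  ∼-C2 sabc sa₁b₁c₁ (_ , _ , Ii , Ii₁ , _ , _ , _ , sdia , sdi₁a₁)
                    (_ , _ , Ij , Ij₁ , _ , _ , _ , sejb , sej₁b₁) =
    let _ , _ , sdek , skhc , Ih = sum-modulo-I sdia sejb sabc Ii Ij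
        _ , h₁ , sdek₁ , sk₁h₁c₁ , Ih₁ = sum-modulo-I sdi₁a₁ sej₁b₁ sa₁b₁c₁ Ii₁ Ij₁
    in ∼-intro skhc (subst (λ x → S x h₁ _) (functional sdek₁ sdek) sk₁h₁c₁) Ih Ih₁

  I⇒∼0 : ∀ {a} → I a → a ∼ 0#
  I⇒∼0 {a} Ia = ∼-intro (neutralˡ a) (neutralˡ 0#) Ia I-zero

  ∼0⇒I : ∀ {a} → a ∼ 0# → I a
  ∼0⇒I (i , _ , Ii , _ , _ , _ , _ , sdia , sdj0) =
    let d≡0 , _ = positive sdj0
    in subst I (functional (neutralˡ i) (subst (λ x → S x i _) d≡0 sdia)) Ii

  ∼-C5 : C5 _∼_
  ∼-C5 {b = b} sabc c∼0 =
    let Ic = ∼0⇒I c∼0 in I⇒∼0 (I-down (b , sabc) Ic) , I⇒∼0 (I-down (right≤ sabc) Ic)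

  ∼-map : (f : Carrier → Carrier) → (∀ {a b c} → S a b c → S (f a) (f b) (f c)) →
          (∀ {a} → I a → I (f a)) → ∀ {a b} → a ∼ b → f a ∼ f b
  ∼-map f f-S f-I (_ , _ , Ii , Ij , _ , _ , _ , sdia , sdjb) =
    ∼-intro (f-S sdia) (f-S sdjb) (f-I Ii) (f-I Ij)

  C3⇒R2 : C3 _∼_ → R2 I
  C3⇒R2 c3 = r2-i , r2-ii
    where
    r2-i : ∀ {i a b d} → I i → i ≤ a → S d i a → Defined S d b →
           ∃[ j ] (I j × j ≤ b × ∃[ e ] (S j e b × Defined S a e))
    r2-i {d = d} Ii _ sdia (_ , sdbc) =
      let _ , b₁∼b , _ , sab₁z = proj₁ (c3 sdbc) _ (∼-intro sdia (neutralʳ d) Ii I-zero)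
          e , _ , j , sj₁eb₁ , sjeb , _ , Ij = ∼-elimˡ b₁∼b
      in j , Ij , (e , sjeb) , e , sjeb , definedˡ-≤ (right≤ sj₁eb₁) sab₁z
    r2-ii : ∀ {i a b e} → I i → i ≤ a → S i e a → Defined S b e →
            ∃[ k ] (I k × k ≤ b × ∃[ f ] (S f k b × Defined S f a))
    r2-ii {e = e} Ii _ siea (_ , sbec) =
      let _ , seia , Ii' = moveʳ siea Ii
          _ , (_ , k , _ , Ik , _ , k≤b , f , sfk₂a₂ , sfkb) , _ , sa₂az =
            proj₂ (c3 sbec) _ (∼-intro seia (neutralʳ e) Ii' I-zero)
      in k , Ik , k≤b , f , sfkb , definedʳ-≤ (_ , sfk₂a₂) sa₂az

  R2⇒C3 : R2 I → C3 _∼_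
  R2⇒C3 (r2-i , r2-ii) sabc = replace-left , replace-right
    where
    replace-left : ∀ a₁ → a₁ ∼ _ → ∃[ b₁ ] (b₁ ∼ _ × Defined S a₁ b₁)
    replace-left a₁ (i₁ , i , Ii₁ , _ , i₁≤a₁ , _ , d , sdi₁a₁ , sdia) =
      let _ , Ij , _ , e , sjeb , a₁e = r2-i Ii₁ i₁≤a₁ sdi₁a₁ (definedʳ-≤ (i , sdia) sabc)
      in e , ∼-introˡ (neutralˡ e) sjeb I-zero Ij , a₁e
    replace-right : ∀ b₂ → b₂ ∼ _ → ∃[ a₂ ] (a₂ ∼ _ × Defined S a₂ b₂)
    replace-right b₂ b₂∼b =
      let e , j₂ , _ , sj₂eb₂ , sjeb , Ij₂ , _ = ∼-elimˡ b₂∼b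
          _ , Ik , _ , f , sfka , fb₂ = r2-ii Ij₂ (e , sj₂eb₂) sj₂eb₂ (definedˡ-≤ (right≤ sjeb) sabc)
      in f , ∼-intro (neutralʳ f) sfka I-zero Ik , fb₂

module R1IdealFacts (P : GPEA) (I : GPEA.Carrier P → Set)
  (idl : OnGPEA.IsIdeal P I) (nm : OnGPEA.Normal P I) (r1 : OnGPEA.R1 P I) where
  open GPEA P
  open OnGPEA P
  open GPEAFacts P
  open NormalIdealFacts P I idl nm

  R1-split : ∀ {k e x y m} → I k → S k e m → S x y m →
             ∃[ k' ] ∃[ z ] ∃[ t ] (I k' × S k' z y × S t z e × ∃[ n ] (S k t n × S x k' n))
  R1-split Ik skem sxym =
    let _ , k' , _ , Ik' , (_ , sj'wx) , (z , sk'zy) , _ , sj'k'm' , k≤m' = r1 Ik sxym (_ , skem)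
        n , sxk'n , snzm = assocʳ sk'zy sxym
        t , sktn = ≤-trans k≤m' (⊕-monoˡ-≤ sj'wx sxk'n sj'k'm')
        _ , stzf , skfm = assocˡ sktn snzm
    in k' , z , t , Ik' , sk'zy , subst (S t z) (cancelˡ skfm skem) stzf , n , sktn , sxk'n

  -- If a = i ⊕ d, b = j ⊕ d = k ⊕ e, c = l ⊕ e, splitting d and e along R1-split
  -- exhibits a common tail z of a and c.
  ∼-trans : ∀ {a b c} → a ∼ b → b ∼ c → a ∼ c
  ∼-trans a∼b b∼c =
    let _ , _ , _ , sida , sjdb , Ii , Ij = ∼-elimˡ a∼b
        _ , _ , _ , skeb , slec , Ik , Il = ∼-elimˡ b∼c
        _ , _ , _ , Ik' , sk'zd , stze , _ , sktn , sjk'n = R1-split Ik skeb sjdb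
        _ , sik'p , spza = assocʳ sk'zd sida
        _ , sltq , sqzc = assocʳ stze slec
        It = I-down (right≤ sktn) (I-closed sjk'n Ij Ik')
    in ∼-introˡ spza sqzc (I-closed sik'p Ii Ik') (I-closed sltq Il It)

  ∼-C1 : C1 _∼_
  ∼-C1 = record { refl = ∼-refl ; sym = ∼-sym ; trans = ∼-trans }

  ∼-C5' : C5' _∼_
  ∼-C5' {b = b} sbcd a∼d =
    let _ , _ , _ , sipa , sjpd , Ii , Ij = ∼-elimˡ a∼d
        _ , c' , _ , Ij₂ , sj₂c'c , ssc'p , _ , sjsq , sbj₂q = R1-split Ij sjpd sbcd
        a₁ , sisa₁ , sa₁c'a = assocʳ ssc'p sipa
        a₁∼b = ∼-trans (∼-introˡ sisa₁ sjsq Ii Ij) (∼-intro sbj₂q (neutralʳ b) Ij₂ I-zero)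
    in a₁ , c' , sa₁c'a , a₁∼b , ∼-introˡ (neutralˡ c') sj₂c'c I-zero Ij₂

  ∼-cancelˡ : ∀ {x y c a a₁} → S x y c → S a a₁ c → x ∼ a → y ∼ a₁
  ∼-cancelˡ {y = y} {a₁ = a₁} sxyc saa₁c (_ , _ , Ii , Ii' , _ , _ , _ , ssix , ssi'a) =
    let _ , siyf , ssfc = assocˡ ssix sxyc
        _ , si'a₁g , ssgc = assocˡ ssi'a saa₁c
        y∼f = ∼-introˡ (neutralˡ y) siyf I-zero Ii
    in ∼-trans y∼f (∼-introˡ (subst (S _ _) (cancelˡ ssgc ssfc) si'a₁g) (neutralˡ a₁) Ii' I-zero)

  ∼-cancelʳ : ∀ {x y c a a₁} → S x y c → S a₁ a c → y ∼ a → x ∼ a₁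
  ∼-cancelʳ {x} {a₁ = a₁} sxyc sa₁ac y∼a =
    let _ , _ , _ , sisy , si'sa , Ii , Ii' = ∼-elimˡ y∼a
        _ , sxif , sfsc = assocʳ sisy sxyc
        _ , sa₁i'g , sgsc = assocʳ si'sa sa₁ac
        x∼f = ∼-intro (neutralʳ x) sxif I-zero Ii
    in ∼-trans x∼f (∼-intro (subst (S _ _) (cancelʳ sgsc sfsc) sa₁i'g) (neutralʳ a₁) Ii' I-zero)

  -- (C4): split c ∼ b ⊕ b₁ by (C5') and cancel the part related to a.
  ∼-C4 : C4 _∼_
  ∼-C4 a∼b (inj₁ (saa₁c , sbb₁d , c∼d)) =
    let _ , _ , sxyc , x∼b , y∼b₁ = ∼-C5' sbb₁d c∼d
    in ∼-trans (∼-sym (∼-cancelˡ sxyc saa₁c (∼-trans x∼b (∼-sym a∼b)))) y∼b₁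
  ∼-C4 a∼b (inj₂ (sa₁ac , sb₁bd , c∼d)) =
    let _ , _ , sxyc , x∼b₁ , y∼b = ∼-C5' sb₁bd c∼d
    in ∼-trans (∼-sym (∼-cancelʳ sxyc sa₁ac (∼-trans y∼b (∼-sym a∼b)))) x∼b₁

module AutomorphismFacts (P : GPEA) (I : GPEA.Carrier P → Set)
  (idl : OnGPEA.IsIdeal P I) (nm : OnGPEA.Normal P I)
  (γ : GPEA.Carrier P → GPEA.Carrier P) (aut : OnGPEA.IsAutomorphism P γ)
  (γI : OnGPEA.γIdeal P I γ) where
  open GPEA P
  open OnGPEA P
  open IsAutomorphism aut
  open NormalIdealFacts P I idl nm

  γ-S : ∀ {a b c} → S a b c → S (γ a) (γ b) (γ c)
  γ-S {a} {b} {c} = to (preserves a b c)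

  γ⁻¹-S : ∀ {a b c} → S a b c → S (γ⁻¹ a) (γ⁻¹ b) (γ⁻¹ c)
  γ⁻¹-S {a} {b} {c} sabc = from (preserves (γ⁻¹ a) (γ⁻¹ b) (γ⁻¹ c)) γγ⁻¹-S
    where
    γγ⁻¹-S : S (γ (γ⁻¹ a)) (γ (γ⁻¹ b)) (γ (γ⁻¹ c))
    γγ⁻¹-S rewrite inverseˡ a | inverseˡ b | inverseˡ c = sabc

  γ⁻¹-I : ∀ {a} → I a → I (γ⁻¹ a)
  γ⁻¹-I {a} Ia = from (γI (γ⁻¹ a)) (subst I (sym (inverseˡ a)) Ia)

  γ-∼ : ∀ {a b} → a ∼ b → γ a ∼ γ b
  γ-∼ = ∼-map γ γ-S (to (γI _))

  γ-reflects-∼ : ∀ {a b} → γ a ∼ γ b → a ∼ b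
  γ-reflects-∼ {a} {b} e = subst₂ _∼_ (inverseʳ a) (inverseʳ b) (∼-map γ⁻¹ γ⁻¹-S γ⁻¹-I e)

  γ⁻¹-∼ : ∀ {p b} → p ∼ γ b → γ⁻¹ p ∼ b
  γ⁻¹-∼ {p} {b} e = γ-reflects-∼ (subst (_∼ γ b) (sym (inverseˡ p)) e)

  γ-∼⇔ : ∀ a b → a ∼ b ⇔ γ a ∼ γ b
  γ-∼⇔ a b = mk⇔ γ-∼ γ-reflects-∼

module UnitizationFacts (P : GPEA) (γ : GPEA.Carrier P → GPEA.Carrier P)
  (aut : OnGPEA.IsAutomorphism P γ) (I : GPEA.Carrier P → Set)
  (idl : OnGPEA.IsIdeal P I) (nm : OnGPEA.Normal P I) (r1 : OnGPEA.R1 P I)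
  (γI : OnGPEA.γIdeal P I γ) where
  open GPEA P
  open OnGPEA P
  open IsAutomorphism aut using (γ⁻¹; inverseˡ)
  open Unitization γ
  module PU = PartialOps SU 0U
  open GPEAFacts P
  open NormalIdealFacts P I idl nm
  open R1IdealFacts P I idl nm r1
  open AutomorphismFacts P I idl nm γ aut γI

  _≈_ : U → U → Set
  _≈_ = _∼_ *

  -- The three shapes of a defined sum in U: a ⊕ b, a + ηb = η(b \ a), ηa + b = η(γb / a).
  data SumView : U → U → U → Set where
    P+P : ∀ {a b c} → S a b c → SumView (inj₁ a) (inj₁ b) (inj₁ c)
    P+η : ∀ {a b d} → S d a b → SumView (inj₁ a) (inj₂ b) (inj₂ d)
    η+P : ∀ {a b d} → S (γ b) d a → SumView (inj₂ a) (inj₁ b) (inj₂ d)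

  view : ∀ {x y z} → SU x y z → SumView x y z
  view {inj₁ _} {inj₁ _} {inj₁ _} s = P+P s
  view {inj₁ _} {inj₂ _} {inj₂ _} (_ , s) = P+η s
  view {inj₂ _} {inj₁ _} {inj₂ _} (_ , s) = η+P s
  view {inj₁ _} {inj₁ _} {inj₂ _} ()
  view {inj₁ _} {inj₂ _} {inj₁ _} ()
  view {inj₂ _} {inj₁ _} {inj₁ _} ()
  view {inj₂ _} {inj₂ _} {inj₁ _} ()
  view {inj₂ _} {inj₂ _} {inj₂ _} ()

  P+η-sum : ∀ {a b d} → S d a b → SU (inj₁ a) (inj₂ b) (inj₂ d)
  P+η-sum sdab = right≤ sdab , sdab

  η+P-sum : ∀ {a b d} → S (γ b) d a → SU (inj₂ a) (inj₁ b) (inj₂ d)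
  η+P-sum sγbda = (_ , sγbda) , sγbda

  η+P-sum⁻ : ∀ {p q a} → S p q a → SU (inj₂ a) (inj₁ (γ⁻¹ p)) (inj₂ q)
  η+P-sum⁻ {p} spqa = η+P-sum (subst (λ x → S x _ _) (sym (inverseˡ p)) spqa)

  ≈-refl : ∀ {x} → x ≈ x
  ≈-refl {inj₁ _} = ∼-refl
  ≈-refl {inj₂ _} = ∼-refl

  ≈-sym : ∀ {x y} → x ≈ y → y ≈ x
  ≈-sym {inj₁ _} {inj₁ _} e = ∼-sym e
  ≈-sym {inj₂ _} {inj₂ _} e = ∼-sym e

  ≈-trans : ∀ {x y z} → x ≈ y → y ≈ z → x ≈ z
  ≈-trans {inj₁ _} {inj₁ _} {inj₁ _} e f = ∼-trans e f
  ≈-trans {inj₂ _} {inj₂ _} {inj₂ _} e f = ∼-trans e f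

  ≈-C1 : PU.C1 _≈_
  ≈-C1 = record { refl = λ {x} → ≈-refl {x} ; sym = λ {x} {y} → ≈-sym {x} {y}
                 ; trans = λ {x} {y} {z} → ≈-trans {x} {y} {z} }

  -- (C2) on U: sums involving η reduce to (C4) on P.
  ≈-C2-view : ∀ {a b c a₁ b₁ c₁} → SumView a b c → SumView a₁ b₁ c₁ → a ≈ a₁ → b ≈ b₁ → c ≈ c₁
  ≈-C2-view (P+P s) (P+P t) e f = ∼-C2 s t e f
  ≈-C2-view (P+η s) (P+η t) e f = ∼-C4 e (inj₂ (s , t , f))
  ≈-C2-view (η+P s) (η+P t) e f = ∼-C4 (γ-∼ f) (inj₁ (s , t , e))
  ≈-C2-view (P+P _) (P+η _) _ ()
  ≈-C2-view (P+P _) (η+P _) () _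
  ≈-C2-view (P+η _) (P+P _) _ ()
  ≈-C2-view (P+η _) (η+P _) () _
  ≈-C2-view (η+P _) (P+P _) () _
  ≈-C2-view (η+P _) (P+η _) () _

  ≈-C2 : PU.C2 _≈_
  ≈-C2 {a} {b} {c} {a₁} {b₁} {c₁} s t = ≈-C2-view (view {a} {b} {c} s) (view {a₁} {b₁} {c₁} t)

  -- (C4) on U, cancelling on the left: η-cases reduce to (C2) and (C4) on P.
  ≈-C4ˡ-view : ∀ {a a₁ c b b₁ d} → SumView a a₁ c → SumView b b₁ d → a ≈ b → c ≈ d → a₁ ≈ b₁
  ≈-C4ˡ-view (P+P s) (P+P t) e f = ∼-C4 e (inj₁ (s , t , f))
  ≈-C4ˡ-view (P+η s) (P+η t) e f = ∼-C2 s t f e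
  ≈-C4ˡ-view (η+P s) (η+P t) e f = γ-reflects-∼ (∼-C4 f (inj₂ (s , t , e)))
  ≈-C4ˡ-view (P+P _) (P+η _) _ ()
  ≈-C4ˡ-view (P+P _) (η+P _) () _
  ≈-C4ˡ-view (P+η _) (P+P _) _ ()
  ≈-C4ˡ-view (P+η _) (η+P _) () _
  ≈-C4ˡ-view (η+P _) (P+P _) () _
  ≈-C4ˡ-view (η+P _) (P+η _) () _

  ≈-C4ʳ-view : ∀ {a₁ a c b₁ b d} → SumView a₁ a c → SumView b₁ b d → a ≈ b → c ≈ d → a₁ ≈ b₁
  ≈-C4ʳ-view (P+P s) (P+P t) e f = ∼-C4 e (inj₂ (s , t , f))
  ≈-C4ʳ-view (P+η s) (P+η t) e f = ∼-C4 f (inj₁ (s , t , e))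
  ≈-C4ʳ-view (η+P s) (η+P t) e f = ∼-C2 s t (γ-∼ e) f
  ≈-C4ʳ-view (P+P _) (P+η _) _ ()
  ≈-C4ʳ-view (P+P _) (η+P _) _ ()
  ≈-C4ʳ-view (P+η _) (P+P _) _ ()
  ≈-C4ʳ-view (P+η _) (η+P _) () _
  ≈-C4ʳ-view (η+P _) (P+P _) _ ()
  ≈-C4ʳ-view (η+P _) (P+η _) () _

  ≈-C4 : PU.C4 _≈_
  ≈-C4 {a} {b} {a₁} {b₁} {c} {d} e (inj₁ (s , t , f)) =
    ≈-C4ˡ-view (view {a} {a₁} {c} s) (view {b} {b₁} {d} t) e f
  ≈-C4 {a} {b} {a₁} {b₁} {c} {d} e (inj₂ (s , t , f)) =
    ≈-C4ʳ-view (view {a₁} {a} {c} s) (view {b₁} {b} {d} t) e f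

  -- The complements in U: x^∼ = ηx and x^- = ηγx for x ∈ P;
  -- (ηx)^∼ = x' with γx' = x, and (ηx)^- = x.
  complementʳ-P : ∀ {x a'} → SU (inj₁ x) a' 1U → a' ≡ inj₂ x
  complementʳ-P {x} {inj₂ _} (_ , s) = cong inj₂ (sym (functional (neutralˡ x) s))

  complementˡ-P : ∀ {x a'} → SU a' (inj₁ x) 1U → a' ≡ inj₂ (γ x)
  complementˡ-P {x} {inj₂ _} (_ , s) = cong inj₂ (sym (functional (neutralʳ (γ x)) s))

  complementʳ-η : ∀ {x a'} → SU (inj₂ x) a' 1U → ∃[ x' ] (a' ≡ inj₁ x' × γ x' ≡ x)
  complementʳ-η {a' = inj₁ x'} (_ , s) = x' , refl , functional (neutralʳ (γ x')) s

  complementˡ-η : ∀ {x a'} → SU a' (inj₂ x) 1U → a' ≡ inj₁ x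
  complementˡ-η {a' = inj₁ x'} (_ , s) = cong inj₁ (functional (neutralˡ x') s)

  -- (C4'): related elements have related complements, by the description above
  -- and γ-invariance of ∼.
  ≈-C4' : PU.C4' _≈_ 1U
  ≈-C4' {inj₁ x} {inj₁ y} e =
    (λ {a'} {b'} s t →
       subst₂ _≈_ (sym (complementʳ-P {x} {a'} s)) (sym (complementʳ-P {y} {b'} t)) e) ,
    (λ {a'} {b'} s t →
       subst₂ _≈_ (sym (complementˡ-P {x} {a'} s)) (sym (complementˡ-P {y} {b'} t)) (γ-∼ e))
  ≈-C4' {inj₂ x} {inj₂ y} e =
    (λ {a'} {b'} s t →
       let x' , a'≡x' , γx'≡x = complementʳ-η {x} {a'} s
           y' , b'≡y' , γy'≡y = complementʳ-η {y} {b'} t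
       in subst₂ _≈_ (sym a'≡x') (sym b'≡y')
            (γ-reflects-∼ (subst₂ _∼_ (sym γx'≡x) (sym γy'≡y) e))) ,
    (λ {a'} {b'} s t →
       subst₂ _≈_ (sym (complementˡ-η {x} {a'} s)) (sym (complementˡ-η {y} {b'} t)) e)

  -- (C5) on U: a sum related to 0 lies in P.
  ≈-C5-view : ∀ {a b c} → SumView a b c → c ≈ 0U → a ≈ 0U × b ≈ 0U
  ≈-C5-view (P+P sabc) e = ∼-C5 sabc e
  ≈-C5-view (P+η _) ()
  ≈-C5-view (η+P _) ()

  ≈-C5 : PU.C5 _≈_
  ≈-C5 {a} {b} {c} s = ≈-C5-view (view {a} {b} {c} s)

  module FromC3 (c3 : C3 _∼_) where

    ≈-replaceˡ : ∀ {a b c} → SumView a b c → ∀ a₁ → a₁ ≈ a → ∃[ b₁ ] (b₁ ≈ b × Defined SU a₁ b₁)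
    ≈-replaceˡ (P+P sabc) (inj₁ a₁) e =
      let b₁ , b₁∼b , c₁ , t = proj₁ (c3 sabc) a₁ e in inj₁ b₁ , b₁∼b , inj₁ c₁ , t
    -- a₁ ∼ a with d ⊕ a = b: by (C3) d₁ ⊕ a₁ = b₁ with d₁ ∼ d, and b₁ ∼ b by (C2).
    ≈-replaceˡ (P+η sdab) (inj₁ a₁) e =
      let d₁ , d₁∼d , b₁ , t = proj₂ (c3 sdab) a₁ e
      in inj₂ b₁ , ∼-C2 t sdab d₁∼d e , inj₂ d₁ , P+η-sum t
    -- a₁ ∼ a = γb ⊕ d: by (C5') a₁ = p ⊕ q with p ∼ γb.
    ≈-replaceˡ (η+P sγbda) (inj₂ a₁) e =
      let p , q , t , p∼γb , _ = ∼-C5' sγbda e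
      in inj₁ (γ⁻¹ p) , γ⁻¹-∼ p∼γb , inj₂ q , η+P-sum⁻ t
    ≈-replaceˡ (P+P _) (inj₂ _) ()
    ≈-replaceˡ (P+η _) (inj₂ _) ()
    ≈-replaceˡ (η+P _) (inj₁ _) ()

    ≈-replaceʳ : ∀ {a b c} → SumView a b c → ∀ b₂ → b₂ ≈ b → ∃[ a₂ ] (a₂ ≈ a × Defined SU a₂ b₂)
    ≈-replaceʳ (P+P sabc) (inj₁ b₂) e =
      let a₂ , a₂∼a , c₂ , t = proj₂ (c3 sabc) b₂ e in inj₁ a₂ , a₂∼a , inj₁ c₂ , t
    -- b₂ ∼ b = d ⊕ a: by (C5') b₂ = p ⊕ q with q ∼ a.
    ≈-replaceʳ (P+η sdab) (inj₂ b₂) e =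
      let p , q , t , _ , q∼a = ∼-C5' sdab e
      in inj₁ q , q∼a , inj₂ p , P+η-sum t
    -- b₂ ∼ b with γb ⊕ d = a: by (C3) γb₂ ⊕ w = a₂ with w ∼ d, and a₂ ∼ a by (C2).
    ≈-replaceʳ (η+P sγbda) (inj₁ b₂) e =
      let w , w∼d , a₂ , t = proj₁ (c3 sγbda) (γ b₂) (γ-∼ e)
      in inj₂ a₂ , ∼-C2 t sγbda (γ-∼ e) w∼d , inj₂ w , η+P-sum t
    ≈-replaceʳ (P+P _) (inj₂ _) ()
    ≈-replaceʳ (P+η _) (inj₁ _) ()
    ≈-replaceʳ (η+P _) (inj₂ _) ()

    ≈-C3 : PU.C3 _≈_
    ≈-C3 {a} {b} {c} s = let v = view {a} {b} {c} s in ≈-replaceˡ v , ≈-replaceʳ v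

    ≈-C5'-view : ∀ {a b c d} → SumView b c d → a ≈ d →
                 ∃[ a₁ ] ∃[ a₂ ] (SU a₁ a₂ a × a₁ ≈ b × a₂ ≈ c)
    ≈-C5'-view {inj₁ a} (P+P sbcd) e =
      let a₁ , a₂ , t , a₁∼b , a₂∼c = ∼-C5' sbcd e in inj₁ a₁ , inj₁ a₂ , t , a₁∼b , a₂∼c
    -- a ∼ d with d ⊕ x = y: by (C3) a ⊕ u = v with u ∼ x, and v ∼ y by (C2).
    ≈-C5'-view {inj₂ a} (P+η sdxy) e =
      let u , u∼x , v , sauv = proj₁ (c3 sdxy) a e
      in inj₁ u , inj₂ v , P+η-sum sauv , u∼x , ∼-C2 sauv sdxy e u∼x
    -- a ∼ d with γy ⊕ d = x: by (C3) w ⊕ a = v with w ∼ γy, and v ∼ x by (C2).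
    ≈-C5'-view {inj₂ a} (η+P sγydx) e =
      let w , w∼γy , v , swav = proj₂ (c3 sγydx) a e
      in inj₂ v , inj₁ (γ⁻¹ w) , η+P-sum⁻ swav , ∼-C2 swav sγydx w∼γy e , γ⁻¹-∼ w∼γy

    ≈-C5' : PU.C5' _≈_
    ≈-C5' {a} {b} {c} {d} s = ≈-C5'-view {a} (view {b} {c} {d} s)

  C3*⇒C3 : PU.C3 _≈_ → C3 _∼_
  C3*⇒C3 c3* {a} {b} {c} sabc = replace-left , replace-right
    where
    replace-left : ∀ a₁ → a₁ ∼ a → ∃[ b₁ ] (b₁ ∼ b × Defined S a₁ b₁)
    replace-left a₁ e with proj₁ (c3* {inj₁ a} {inj₁ b} {inj₁ c} sabc) (inj₁ a₁) e
    ... | inj₁ b₁ , b₁∼b , inj₁ c₁ , t = b₁ , b₁∼b , c₁ , t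
    replace-right : ∀ b₂ → b₂ ∼ b → ∃[ a₂ ] (a₂ ∼ a × Defined S a₂ b₂)
    replace-right b₂ e with proj₂ (c3* {inj₁ a} {inj₁ b} {inj₁ c} sabc) (inj₁ b₂) e
    ... | inj₁ a₂ , a₂∼a , inj₁ c₂ , t = a₂ , a₂∼a , c₂ , t

proposition4p18 :
    (P : GPEA) → let open GPEA P in let open OnGPEA P in
    (γ : Carrier → Carrier) → IsAutomorphism γ → Unitizing γ →
    (I : Carrier → Set) → IsIdeal I → Normal I → R1 I → γIdeal I γ →
    let open Unitization γ in
    let module PU = PartialOps SU 0U in
    let _∼_ = _∼I_ I in
    let _∼*_ = _∼_ * in
    (PU.C3 _∼*_ ⇔ (IsIdeal I × Normal I × Riesz I × γIdeal I γ)) ×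
    ((IsIdeal I × Normal I × Riesz I × γIdeal I γ) ⇔
       (γCongruence γ _∼_ × C4 _∼_ × C5' _∼_)) ×
    ((γCongruence γ _∼_ × C4 _∼_ × C5' _∼_) ⇔
       (PU.Congruence _∼*_ × PU.C4 _∼*_ × PU.C4' _∼*_ 1U ×
        PU.C5' _∼*_ × PU.C5 _∼*_))
proposition4p18 P γ aut _ I idl nm r1 γI =
  mk⇔ (ii ∘′ C3*⇒C3) (FromC3.≈-C3 ∘′ c3-of-ii) ,
  mk⇔ (iii ∘′ c3-of-ii) (ii ∘′ c3-of-iii) ,
  mk⇔ (iv ∘′ c3-of-iii) (iii ∘′ C3*⇒C3 ∘′ c3*-of-iv)
  where
  open OnGPEA P
  open Unitization γ
  open NormalIdealFacts P I idl nm
  open R1IdealFacts P I idl nm r1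
  open AutomorphismFacts P I idl nm γ aut γI
  open UnitizationFacts P γ aut I idl nm r1 γI

  Cond-ii Cond-iii Cond-iv : Set
  Cond-ii = IsIdeal I × Normal I × Riesz I × γIdeal I γ
  Cond-iii = γCongruence γ _∼_ × C4 _∼_ × C5' _∼_
  Cond-iv = PU.Congruence _≈_ × PU.C4 _≈_ × PU.C4' _≈_ 1U × PU.C5' _≈_ × PU.C5 _≈_

  -- Each condition yields (C3) for ∼ on P ...
  c3-of-ii : Cond-ii → C3 _∼_
  c3-of-ii (_ , _ , (_ , r2) , _) = R2⇒C3 r2

  c3-of-iii : Cond-iii → C3 _∼_
  c3-of-iii (((_ , _ , c3) , _) , _) = c3

  c3*-of-iv : Cond-iv → PU.C3 _≈_
  c3*-of-iv ((_ , _ , c3*) , _) = c3*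

  -- ... and conversely, since all other requirements hold unconditionally.
  ii : C3 _∼_ → Cond-ii
  ii c3 = idl , nm , (r1 , C3⇒R2 c3) , γI

  iii : C3 _∼_ → Cond-iii
  iii c3 = ((∼-C1 , ∼-C2 , c3) , γ-∼⇔) , ∼-C4 , ∼-C5'

  -- The implicit arguments of the U-level laws are passed on explicitly,
  -- since SU is defined by pattern matching and cannot be inverted by unification.
  iv : C3 _∼_ → Cond-iv
  iv c3 = (≈-C1 , (λ {a b c a₁ b₁ c₁} → ≈-C2 {a} {b} {c} {a₁} {b₁} {c₁}) , FromC3.≈-C3 c3) ,
           (λ {a b a₁ b₁ c d} → ≈-C4 {a} {b} {a₁} {b₁} {c} {d}) , ≈-C4' ,
           FromC3.≈-C5' c3 , (λ {a b c} → ≈-C5 {a} {b} {c})
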